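{- Let $(\mathbf{V},\mathbf{C},F\dashv G)$ be a CLNL model with $!=F\circ G$, unit $\eta:\mathrm{Id}\Rightarrow G\circ F$ and counit $\epsilon:\,!\Rightarrow\mathrm{Id}$. For intuitionistic types $P_1,P_2$, if $f:[\![P_1]\!]\to[\![P_2]\!]$ is an intuitionistic morphism, then $\diamond_{P_2}\circ f=\diamond_{P_1}$, $\Delta_{P_2}\circ f=(f\otimes f)\circ\Delta_{P_1}$, and $\mathbf{lift}_{P_2}\circ f=\,!f\circ\mathbf{lift}_{P_1}$.
   Context: A CLNL model consists of a cartesian closed category $\mathbf{V}$ with finite coproducts (product $\times$, terminal $1$, coproduct $\amalg$, initial $\varnothing$), a symmetric monoidal closed category $\mathbf{C}$ with finite coproducts (tensor $\otimes$, hom $\multimap$, unit $I$, coproduct $+$, initial $0$), and a symmetric monoidal adjunction $F\dashv G$, $F:\mathbf{V}\to\mathbf{C}$. Types: $A,B::=0\mid A+B\mid I\mid A\otimes B\mid A\multimap B\mid !A$; intuitionistic types: $P,R::=0\mid P+R\mid I\mid P\otimes R\mid !A$. Types are interpreted in $\mathbf{C}$ by $[\![0]\!]=0$, $[\![A+B]\!]=[\![A]\!]+[\![B]\!]$, $[\![I]\!]=I$, $[\![A\otimes B]\!]=[\![A]\!]\otimes[\![B]\!]$, $[\![A\multimap B]\!]=[\![A]\!]\multimap[\![B]\!]$, $[\![!A]\!]=\,![\![A]\!]$. For each intuitionistic $P$ there is an object $X$ of $\mathbf{V}$ and a canonical isomorphism $[\![P]\!]\cong F(X)$, built inductively from the canonical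 isomorphisms $I\cong F(1)$, $0\cong F(\varnothing)$, $F(X)\otimes F(Y)\cong F(X\times Y)$, $F(X)+F(Y)\cong F(X\amalg Y)$ and $!A=F(GA)$; these isomorphisms are used below. A morphism $f:[\![P_1]\!]\to[\![P_2]\!]$ is \emph{intuitionistic} if $f$ equals the composite $[\![P_1]\!]\cong F(X)\xrightarrow{F(f')}F(Y)\cong[\![P_2]\!]$ for some $f'\in\mathbf{V}(X,Y)$. For intuitionistic $P$ with $[\![P]\!]\cong F(X)$ define: discard $\diamond_P:[\![P]\!]\cong F(X)\xrightarrow{F(!_X)}F(1)\cong I$ (where $!_X:X\to1$ is the unique map); copy $\Delta_P:[\![P]\!]\cong F(X)\xrightarrow{F(\langle\mathrm{id},\mathrm{id}\rangle)}F(X\times X)\cong[\![P]\!]\otimes[\![P]\!]$; lift $\mathbf{lift}_P:[\![P]\!]\cong F(X)\xrightarrow{F(\eta_X)}\,!F(X)\cong\,![\![P]\!]$. -}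

module Defs where

open import Level using (Level; _⊔_) renaming (suc to lsuc)
open import Relation.Binary.Core using (Rel)
open import Relation.Binary.Structures using (IsEquivalence)
open import Data.Product using (Σ; _×_; _,_)

record Category (o ℓ e : Level) : Set (lsuc (o ⊔ ℓ ⊔ e)) where
  infixr 9 _∘_
  infix  4 _≈_
  infix  4 _⇒_
  field
    Obj       : Set o
    _⇒_       : Obj → Obj → Set ℓ
    _≈_       : ∀ {A B} → Rel (A ⇒ B) e
    id        : ∀ {A} → A ⇒ A
    _∘_       : ∀ {A B C} → B ⇒ C → A ⇒ B → A ⇒ C
    equiv     : ∀ {A B} → IsEquivalence (_≈_ {A} {B})
    assoc     : ∀ {A B C D} {f : A ⇒ B} {g : B ⇒ C} {h : C ⇒ D} →
                (h ∘ g) ∘ f ≈ h ∘ (g ∘ f)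
    identityˡ : ∀ {A B} {f : A ⇒ B} → id ∘ f ≈ f
    identityʳ : ∀ {A B} {f : A ⇒ B} → f ∘ id ≈ f
    ∘-resp-≈  : ∀ {A B C} {f h : B ⇒ C} {g i : A ⇒ B} →
                f ≈ h → g ≈ i → f ∘ g ≈ h ∘ i

record Functor {o ℓ e o′ ℓ′ e′} (C : Category o ℓ e) (D : Category o′ ℓ′ e′)
       : Set (o ⊔ ℓ ⊔ e ⊔ o′ ⊔ ℓ′ ⊔ e′) where
  private
    module C = Category C
    module D = Category D
  field
    F₀           : C.Obj → D.Obj
    F₁           : ∀ {A B} → A C.⇒ B → F₀ A D.⇒ F₀ B
    identity     : ∀ {A} → F₁ (C.id {A}) D.≈ D.id
    homomorphism : ∀ {X Y Z} {f : X C.⇒ Y} {g : Y C.⇒ Z} →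
                   F₁ (g C.∘ f) D.≈ F₁ g D.∘ F₁ f
    F-resp-≈     : ∀ {A B} {f g : A C.⇒ B} → f C.≈ g → F₁ f D.≈ F₁ g

record FiniteProducts {o ℓ e} (C : Category o ℓ e) : Set (o ⊔ ℓ ⊔ e) where
  open Category C
  infixr 7 _×₀_
  field
    ⊤        : Obj
    !        : ∀ {A} → A ⇒ ⊤
    !-unique : ∀ {A} (f : A ⇒ ⊤) → ! ≈ f
    _×₀_     : Obj → Obj → Obj
    π₁       : ∀ {A B} → A ×₀ B ⇒ A
    π₂       : ∀ {A B} → A ×₀ B ⇒ B
    ⟨_,_⟩    : ∀ {X A B} → X ⇒ A → X ⇒ B → X ⇒ A ×₀ B
    project₁ : ∀ {X A B} {f : X ⇒ A} {g : X ⇒ B} → π₁ ∘ ⟨ f , g ⟩ ≈ f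
    project₂ : ∀ {X A B} {f : X ⇒ A} {g : X ⇒ B} → π₂ ∘ ⟨ f , g ⟩ ≈ g
    ⟨⟩-unique : ∀ {X A B} {f : X ⇒ A} {g : X ⇒ B} {h : X ⇒ A ×₀ B} →
                π₁ ∘ h ≈ f → π₂ ∘ h ≈ g → ⟨ f , g ⟩ ≈ h

  infixr 8 _⁂_
  _⁂_ : ∀ {A B C D} → A ⇒ B → C ⇒ D → A ×₀ C ⇒ B ×₀ D
  f ⁂ g = ⟨ f ∘ π₁ , g ∘ π₂ ⟩

record Exponentials {o ℓ e} {C : Category o ℓ e} (P : FiniteProducts C)
       : Set (o ⊔ ℓ ⊔ e) where
  open Category C
  open FiniteProducts P
  field
    _⇨_      : Obj → Obj → Obj
    eval     : ∀ {B A} → (B ⇨ A) ×₀ B ⇒ A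
    λg       : ∀ {X B A} → X ×₀ B ⇒ A → X ⇒ B ⇨ A
    β        : ∀ {X B A} {f : X ×₀ B ⇒ A} → eval ∘ (λg f ⁂ id) ≈ f
    λ-unique : ∀ {X B A} {f : X ×₀ B ⇒ A} {h : X ⇒ B ⇨ A} →
               eval ∘ (h ⁂ id) ≈ f → h ≈ λg f

record FiniteCoproducts {o ℓ e} (C : Category o ℓ e) : Set (o ⊔ ℓ ⊔ e) where
  open Category C
  infixr 6 _+₀_
  field
    ⊥        : Obj
    ¡        : ∀ {A} → ⊥ ⇒ A
    ¡-unique : ∀ {A} (f : ⊥ ⇒ A) → ¡ ≈ f
    _+₀_     : Obj → Obj → Obj
    i₁       : ∀ {A B} → A ⇒ A +₀ B
    i₂       : ∀ {A B} → B ⇒ A +₀ B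
    [_,_]    : ∀ {A B X} → A ⇒ X → B ⇒ X → A +₀ B ⇒ X
    inject₁  : ∀ {A B X} {f : A ⇒ X} {g : B ⇒ X} → [ f , g ] ∘ i₁ ≈ f
    inject₂  : ∀ {A B X} {f : A ⇒ X} {g : B ⇒ X} → [ f , g ] ∘ i₂ ≈ g
    []-unique : ∀ {A B X} {f : A ⇒ X} {g : B ⇒ X} {h : A +₀ B ⇒ X} →
                h ∘ i₁ ≈ f → h ∘ i₂ ≈ g → [ f , g ] ≈ h

  _⊕₁_ : ∀ {A B C D} → A ⇒ B → C ⇒ D → A +₀ C ⇒ B +₀ D
  f ⊕₁ g = [ i₁ ∘ f , i₂ ∘ g ]

record MonoidalData {o ℓ e} (C : Category o ℓ e) : Set (o ⊔ ℓ ⊔ e) where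
  open Category C
  infixr 10 _⊗₀_ _⊗₁_
  field
    _⊗₀_    : Obj → Obj → Obj
    _⊗₁_    : ∀ {A B C D} → A ⇒ B → C ⇒ D → A ⊗₀ C ⇒ B ⊗₀ D
    unit    : Obj
    α⇒      : ∀ {A B C} → (A ⊗₀ B) ⊗₀ C ⇒ A ⊗₀ (B ⊗₀ C)
    λ⇒      : ∀ {A} → unit ⊗₀ A ⇒ A
    ρ⇒      : ∀ {A} → A ⊗₀ unit ⇒ A
    σ       : ∀ {A B} → A ⊗₀ B ⇒ B ⊗₀ A

record SymmetricMonoidal {o ℓ e} (C : Category o ℓ e) : Set (o ⊔ ℓ ⊔ e) where
  open Category C
  field
    monoidalData : MonoidalData C
  open MonoidalData monoidalData public
  field
    ⊗-identity : ∀ {A B} → id {A} ⊗₁ id {B} ≈ id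
    ⊗-homo     : ∀ {A B C D E F} {f : A ⇒ B} {g : B ⇒ C} {h : D ⇒ E} {k : E ⇒ F} →
                 (g ∘ f) ⊗₁ (k ∘ h) ≈ (g ⊗₁ k) ∘ (f ⊗₁ h)
    ⊗-resp-≈   : ∀ {A B C D} {f f′ : A ⇒ B} {g g′ : C ⇒ D} →
                 f ≈ f′ → g ≈ g′ → f ⊗₁ g ≈ f′ ⊗₁ g′
    α⇐         : ∀ {A B C} → A ⊗₀ (B ⊗₀ C) ⇒ (A ⊗₀ B) ⊗₀ C
    α-isoˡ     : ∀ {A B C} → α⇐ ∘ α⇒ {A} {B} {C} ≈ id
    α-isoʳ     : ∀ {A B C} → α⇒ ∘ α⇐ {A} {B} {C} ≈ id
    α-natural  : ∀ {A B C D E F} {f : A ⇒ D} {g : B ⇒ E} {h : C ⇒ F} →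
                 α⇒ ∘ ((f ⊗₁ g) ⊗₁ h) ≈ (f ⊗₁ (g ⊗₁ h)) ∘ α⇒
    λ⇐         : ∀ {A} → A ⇒ unit ⊗₀ A
    λ-isoˡ     : ∀ {A} → λ⇐ ∘ λ⇒ {A} ≈ id
    λ-isoʳ     : ∀ {A} → λ⇒ ∘ λ⇐ {A} ≈ id
    λ-natural  : ∀ {A B} {f : A ⇒ B} → λ⇒ ∘ (id ⊗₁ f) ≈ f ∘ λ⇒
    ρ⇐         : ∀ {A} → A ⇒ A ⊗₀ unit
    ρ-isoˡ     : ∀ {A} → ρ⇐ ∘ ρ⇒ {A} ≈ id
    ρ-isoʳ     : ∀ {A} → ρ⇒ ∘ ρ⇐ {A} ≈ id
    ρ-natural  : ∀ {A B} {f : A ⇒ B} → ρ⇒ ∘ (f ⊗₁ id) ≈ f ∘ ρ⇒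
    σ-natural  : ∀ {A B C D} {f : A ⇒ B} {g : C ⇒ D} →
                 σ ∘ (f ⊗₁ g) ≈ (g ⊗₁ f) ∘ σ
    σ-involutive : ∀ {A B} → σ {B} {A} ∘ σ {A} {B} ≈ id
    pentagon   : ∀ {A B C D} →
                 α⇒ {A} {B} {C ⊗₀ D} ∘ α⇒ {A ⊗₀ B} {C} {D}
                   ≈ (id ⊗₁ α⇒) ∘ (α⇒ ∘ (α⇒ ⊗₁ id))
    triangle   : ∀ {A B} → (id {A} ⊗₁ λ⇒ {B}) ∘ α⇒ ≈ ρ⇒ ⊗₁ id
    hexagon    : ∀ {A B C} →
                 α⇒ {B} {C} {A} ∘ (σ ∘ α⇒ {A} {B} {C})
                   ≈ (id ⊗₁ σ) ∘ (α⇒ ∘ (σ ⊗₁ id))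

record SymmetricMonoidalClosed {o ℓ e} (C : Category o ℓ e) : Set (o ⊔ ℓ ⊔ e) where
  open Category C
  field
    symmetricMonoidal : SymmetricMonoidal C
  open SymmetricMonoidal symmetricMonoidal public
  field
    _⊸_        : Obj → Obj → Obj
    ev         : ∀ {A B} → (A ⊸ B) ⊗₀ A ⇒ B
    curry      : ∀ {X A B} → X ⊗₀ A ⇒ B → X ⇒ A ⊸ B
    curry-β    : ∀ {X A B} {f : X ⊗₀ A ⇒ B} → ev ∘ (curry f ⊗₁ id) ≈ f
    curry-unique : ∀ {X A B} {f : X ⊗₀ A ⇒ B} {h : X ⇒ A ⊸ B} →
                   ev ∘ (h ⊗₁ id) ≈ f → h ≈ curry f

cartesianData : ∀ {o ℓ e} {C : Category o ℓ e} → FiniteProducts C → MonoidalData C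
cartesianData {C = C} P = record
  { _⊗₀_ = _×₀_
  ; _⊗₁_ = _⁂_
  ; unit = ⊤
  ; α⇒   = ⟨ π₁ ∘ π₁ , ⟨ π₂ ∘ π₁ , π₂ ⟩ ⟩
  ; λ⇒   = π₂
  ; ρ⇒   = π₁
  ; σ    = ⟨ π₂ , π₁ ⟩
  }
  where
  open Category C
  open FiniteProducts P

record LaxSymmetricMonoidal {o ℓ e o′ ℓ′ e′}
       {C : Category o ℓ e} {D : Category o′ ℓ′ e′}
       (MC : MonoidalData C) (MD : MonoidalData D) (F : Functor C D)
       : Set (o ⊔ ℓ ⊔ e ⊔ o′ ⊔ ℓ′ ⊔ e′) where
  private
    module C  = Category C
    module D  = Category D
    module MC = MonoidalData MC
    module MD = MonoidalData MD
  open Functor F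
  field
    φ         : ∀ {A B} → F₀ A MD.⊗₀ F₀ B D.⇒ F₀ (A MC.⊗₀ B)
    φ₀        : MD.unit D.⇒ F₀ MC.unit
    φ-natural : ∀ {A B C′ D′} {f : A C.⇒ B} {g : C′ C.⇒ D′} →
                φ D.∘ (F₁ f MD.⊗₁ F₁ g) D.≈ F₁ (f MC.⊗₁ g) D.∘ φ
    assoc     : ∀ {A B C′} →
                F₁ (MC.α⇒ {A} {B} {C′}) D.∘ (φ D.∘ (φ MD.⊗₁ D.id))
                  D.≈ φ D.∘ ((D.id MD.⊗₁ φ) D.∘ MD.α⇒)
    unitaryˡ  : ∀ {A} → F₁ (MC.λ⇒ {A}) D.∘ (φ D.∘ (φ₀ MD.⊗₁ D.id)) D.≈ MD.λ⇒
    unitaryʳ  : ∀ {A} → F₁ (MC.ρ⇒ {A}) D.∘ (φ D.∘ (D.id MD.⊗₁ φ₀)) D.≈ MD.ρ⇒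
    braiding  : ∀ {A B} → F₁ (MC.σ {A} {B}) D.∘ φ D.≈ φ D.∘ MD.σ

record CLNL (o ℓ e o′ ℓ′ e′ : Level)
       : Set (lsuc (o ⊔ ℓ ⊔ e ⊔ o′ ⊔ ℓ′ ⊔ e′)) where
  field
    V    : Category o ℓ e
    C    : Category o′ ℓ′ e′
    Vprod  : FiniteProducts V
    Vexp   : Exponentials Vprod
    Vcoprod : FiniteCoproducts V
    Csmc   : SymmetricMonoidalClosed C
    Ccoprod : FiniteCoproducts C
    F    : Functor V C
    G    : Functor C V
  module V = Category V
  module C = Category C
  module VP = FiniteProducts Vprod
  module VC = FiniteCoproducts Vcoprod
  module CM = SymmetricMonoidalClosed Csmc
  module CC = FiniteCoproducts Ccoprod
  module F = Functor F
  module G = Functor G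
  field
    η          : ∀ X → X V.⇒ G.F₀ (F.F₀ X)
    ε          : ∀ A → F.F₀ (G.F₀ A) C.⇒ A
    η-natural  : ∀ {X Y} {f : X V.⇒ Y} →
                 G.F₁ (F.F₁ f) V.∘ η X V.≈ η Y V.∘ f
    ε-natural  : ∀ {A B} {f : A C.⇒ B} →
                 f C.∘ ε A C.≈ ε B C.∘ F.F₁ (G.F₁ f)
    zig        : ∀ {X} → ε (F.F₀ X) C.∘ F.F₁ (η X) C.≈ C.id
    zag        : ∀ {A} → G.F₁ (ε A) V.∘ η (G.F₀ A) V.≈ V.id
    Fmon : LaxSymmetricMonoidal (cartesianData Vprod) CM.monoidalData F
    Gmon : LaxSymmetricMonoidal CM.monoidalData (cartesianData Vprod) G
  module Fm = LaxSymmetricMonoidal Fmon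
  module Gm = LaxSymmetricMonoidal Gmon
  field
    η-monoidal  : ∀ {X Y} →
                  η (X VP.×₀ Y) V.≈ G.F₁ Fm.φ V.∘ (Gm.φ V.∘ (η X VP.⁂ η Y))
    η-monoidal₀ : η VP.⊤ V.≈ G.F₁ Fm.φ₀ V.∘ Gm.φ₀
    ε-monoidal  : ∀ {A B} →
                  ε (A CM.⊗₀ B) C.∘ (F.F₁ Gm.φ C.∘ Fm.φ) C.≈ ε A CM.⊗₁ ε B
    ε-monoidal₀ : ε CM.unit C.∘ (F.F₁ Gm.φ₀ C.∘ Fm.φ₀) C.≈ C.id
    φ⁻¹        : ∀ {X Y} → F.F₀ (X VP.×₀ Y) C.⇒ F.F₀ X CM.⊗₀ F.F₀ Y
    φ-isoˡ     : ∀ {X Y} → φ⁻¹ C.∘ Fm.φ {X} {Y} C.≈ C.id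
    φ-isoʳ     : ∀ {X Y} → Fm.φ C.∘ φ⁻¹ {X} {Y} C.≈ C.id
    φ₀⁻¹       : F.F₀ VP.⊤ C.⇒ CM.unit
    φ₀-isoˡ    : φ₀⁻¹ C.∘ Fm.φ₀ C.≈ C.id
    φ₀-isoʳ    : Fm.φ₀ C.∘ φ₀⁻¹ C.≈ C.id

  !₀ : C.Obj → C.Obj
  !₀ A = F.F₀ (G.F₀ A)

  !₁ : ∀ {A B} → A C.⇒ B → !₀ A C.⇒ !₀ B
  !₁ f = F.F₁ (G.F₁ f)

  -- canonical isomorphisms F X + F Y ≅ F (X ∐ Y) and 0 ≅ F ∅
  -- (F X + F Y → F (X ∐ Y) is [F i₁ , F i₂]; its inverse is the transpose
  --  of [G i₁ ∘ η , G i₂ ∘ η]; 0 → F ∅ is ¡, with inverse the transpose of ¡)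
  +→F : ∀ {X Y} → F.F₀ X CC.+₀ F.F₀ Y C.⇒ F.F₀ (X VC.+₀ Y)
  +→F = CC.[ F.F₁ VC.i₁ , F.F₁ VC.i₂ ]

  F→+ : ∀ {X Y} → F.F₀ (X VC.+₀ Y) C.⇒ F.F₀ X CC.+₀ F.F₀ Y
  F→+ {X} {Y} = ε _ C.∘ F.F₁ VC.[ G.F₁ CC.i₁ V.∘ η X , G.F₁ CC.i₂ V.∘ η Y ]

  0→F : CC.⊥ C.⇒ F.F₀ VC.⊥
  0→F = CC.¡

  F→0 : F.F₀ VC.⊥ C.⇒ CC.⊥
  F→0 = ε CC.⊥ C.∘ F.F₁ VC.¡

infixr 6 _⊕_
infixr 7 _⊗_
infixr 5 _⊸_
data Ty : Set where
  𝟘   : Ty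
  _⊕_ : Ty → Ty → Ty
  𝟙   : Ty
  _⊗_ : Ty → Ty → Ty
  _⊸_ : Ty → Ty → Ty
  !_  : Ty → Ty

data Intuitionistic : Ty → Set where
  𝟘   : Intuitionistic 𝟘
  _⊕_ : ∀ {P R} → Intuitionistic P → Intuitionistic R → Intuitionistic (P ⊕ R)
  𝟙   : Intuitionistic 𝟙
  _⊗_ : ∀ {P R} → Intuitionistic P → Intuitionistic R → Intuitionistic (P ⊗ R)
  !_  : ∀ A → Intuitionistic (! A)

module _ {o ℓ e o′ ℓ′ e′} (M : CLNL o ℓ e o′ ℓ′ e′) where
  open CLNL M

  ⟦_⟧ : Ty → C.Obj
  ⟦ 𝟘 ⟧     = CC.⊥
  ⟦ A ⊕ B ⟧ = ⟦ A ⟧ CC.+₀ ⟦ B ⟧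
  ⟦ 𝟙 ⟧     = CM.unit
  ⟦ A ⊗ B ⟧ = ⟦ A ⟧ CM.⊗₀ ⟦ B ⟧
  ⟦ A ⊸ B ⟧ = ⟦ A ⟧ CM.⊸ ⟦ B ⟧
  ⟦ ! A ⟧   = !₀ ⟦ A ⟧

  -- the object X of V with ⟦ P ⟧ ≅ F X
  under : ∀ {P} → Intuitionistic P → V.Obj
  under 𝟘       = VC.⊥
  under (p ⊕ r) = under p VC.+₀ under r
  under 𝟙       = VP.⊤
  under (p ⊗ r) = under p VP.×₀ under r
  under (! A)   = G.F₀ ⟦ A ⟧

  toF   : ∀ {P} (p : Intuitionistic P) → ⟦ P ⟧ C.⇒ F.F₀ (under p)
  fromF : ∀ {P} (p : Intuitionistic P) → F.F₀ (under p) C.⇒ ⟦ P ⟧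
  toF 𝟘       = 0→F
  toF (p ⊕ r) = +→F C.∘ (toF p CC.⊕₁ toF r)
  toF 𝟙       = Fm.φ₀
  toF (p ⊗ r) = Fm.φ C.∘ (toF p CM.⊗₁ toF r)
  toF (! A)   = C.id
  fromF 𝟘       = F→0
  fromF (p ⊕ r) = (fromF p CC.⊕₁ fromF r) C.∘ F→+
  fromF 𝟙       = φ₀⁻¹
  fromF (p ⊗ r) = (fromF p CM.⊗₁ fromF r) C.∘ φ⁻¹
  fromF (! A)   = C.id

  IsIntuitionisticMor : ∀ {P₁ P₂} (p₁ : Intuitionistic P₁) (p₂ : Intuitionistic P₂) →
                        ⟦ P₁ ⟧ C.⇒ ⟦ P₂ ⟧ → Set (ℓ ⊔ e′)
  IsIntuitionisticMor p₁ p₂ f =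
    Σ (under p₁ V.⇒ under p₂) λ f′ → f C.≈ fromF p₂ C.∘ (F.F₁ f′ C.∘ toF p₁)

  discard : ∀ {P} (p : Intuitionistic P) → ⟦ P ⟧ C.⇒ CM.unit
  discard p = φ₀⁻¹ C.∘ (F.F₁ VP.! C.∘ toF p)

  copy : ∀ {P} (p : Intuitionistic P) → ⟦ P ⟧ C.⇒ ⟦ P ⟧ CM.⊗₀ ⟦ P ⟧
  copy p = fromF (p ⊗ p) C.∘ (F.F₁ VP.⟨ V.id , V.id ⟩ C.∘ toF p)

  lift : ∀ {P} (p : Intuitionistic P) → ⟦ P ⟧ C.⇒ !₀ ⟦ P ⟧
  lift p = !₁ (fromF p) C.∘ (F.F₁ (η (under p)) C.∘ toF p)

module Submission where

-- Every structural map s_P of an intuitionistic type P (discard, copy, lift)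
-- has the shape  a ∘ F k ∘ toF P,  where toF P : ⟦ P ⟧ → F X is the canonical
-- comparison map and k is a map of V (the terminal map, the diagonal, the unit
-- η).  An intuitionistic f = fromF P₂ ∘ F f′ ∘ toF P₁ therefore satisfies
-- toF P₂ ∘ f ≈ F f′ ∘ toF P₁, provided toF ∘ fromF ≈ id; and then
-- s_P₂ ∘ f ≈ a₂ ∘ F (k ∘ f′) ∘ toF P₁, so it suffices to move f′ past k in V
-- (k is natural: ! ∘ f′ = !, Δ ∘ f′ = (f′ × f′) ∘ Δ, η ∘ f′ = GF f′ ∘ η).

open import Defs
open import Data.Product using (_×_; _,_)
open import Relation.Binary.Bundles using (Setoid)
open import Relation.Binary.Structures using (IsEquivalence)
import Relation.Binary.Reasoning.Setoid as SetoidReasoning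

module HomReasoning {o ℓ e} (𝒞 : Category o ℓ e) where
  open Category 𝒞

  module Equivalence {A B} = IsEquivalence (equiv {A} {B})
  open Equivalence public
    using () renaming (refl to ≈-refl; sym to ≈-sym; trans to ≈-trans)

  hom : Obj → Obj → Setoid ℓ e
  hom A B = record { Carrier = A ⇒ B ; _≈_ = _≈_ ; isEquivalence = equiv }

  module Reasoning {A B} = SetoidReasoning (hom A B)
  open Reasoning public using (begin_; _∎; step-≈-⟩; step-≈-⟨)

  infixr 4 _⟩∘⟨_ refl⟩∘⟨_
  infixl 5 _⟩∘⟨refl

  _⟩∘⟨_ : ∀ {A B C} {f h : B ⇒ C} {g i : A ⇒ B} → f ≈ h → g ≈ i → f ∘ g ≈ h ∘ i
  _⟩∘⟨_ = ∘-resp-≈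

  refl⟩∘⟨_ : ∀ {A B C} {f : B ⇒ C} {g i : A ⇒ B} → g ≈ i → f ∘ g ≈ f ∘ i
  refl⟩∘⟨ p = ≈-refl ⟩∘⟨ p

  _⟩∘⟨refl : ∀ {A B C} {f h : B ⇒ C} {g : A ⇒ B} → f ≈ h → f ∘ g ≈ h ∘ g
  p ⟩∘⟨refl = p ⟩∘⟨ ≈-refl

  assoc˘ : ∀ {A B C D} {f : A ⇒ B} {g : B ⇒ C} {h : C ⇒ D} →
           h ∘ (g ∘ f) ≈ (h ∘ g) ∘ f
  assoc˘ = ≈-sym assoc

  glue : ∀ {A B C D E F} {u : C ⇒ E} {v : B ⇒ C} {w : A ⇒ B}
           {t : A ⇒ D} {m : D ⇒ C} {s : D ⇒ F} {s′ : F ⇒ E} →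
         u ∘ m ≈ s′ ∘ s → v ∘ w ≈ m ∘ t → (u ∘ v) ∘ w ≈ s′ ∘ (s ∘ t)
  glue {u = u} {v} {w} {t} {m} {s} {s′} p q = begin
    (u ∘ v) ∘ w    ≈⟨ assoc ⟩
    u ∘ (v ∘ w)    ≈⟨ refl⟩∘⟨ q ⟩
    u ∘ (m ∘ t)    ≈⟨ assoc˘ ⟩
    (u ∘ m) ∘ t    ≈⟨ p ⟩∘⟨refl ⟩
    (s′ ∘ s) ∘ t   ≈⟨ assoc ⟩
    s′ ∘ (s ∘ t)   ∎

  section-∘ : ∀ {A B C} {u : B ⇒ C} {u′ : C ⇒ B} {m : A ⇒ B} {m′ : B ⇒ A} →
              u ∘ u′ ≈ id → m ∘ m′ ≈ id → (u ∘ m) ∘ (m′ ∘ u′) ≈ id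
  section-∘ {u = u} {u′} {m} {m′} uu′ mm′ = begin
    (u ∘ m) ∘ (m′ ∘ u′)   ≈⟨ assoc ⟩
    u ∘ (m ∘ (m′ ∘ u′))   ≈⟨ refl⟩∘⟨ assoc˘ ⟩
    u ∘ ((m ∘ m′) ∘ u′)   ≈⟨ refl⟩∘⟨ mm′ ⟩∘⟨refl ⟩
    u ∘ (id ∘ u′)         ≈⟨ refl⟩∘⟨ identityˡ ⟩
    u ∘ u′                ≈⟨ uu′ ⟩
    id                    ∎

  inverse-commutes : ∀ {A B C D} {φ : A ⇒ B} {φ′ : C ⇒ D} {φ⁻¹ : D ⇒ C}
                       {x : A ⇒ C} {y : B ⇒ D} {ψ⁻¹ : B ⇒ A} →
                     φ′ ∘ x ≈ y ∘ φ → φ⁻¹ ∘ φ′ ≈ id → φ ∘ ψ⁻¹ ≈ id →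
                     φ⁻¹ ∘ y ≈ x ∘ ψ⁻¹
  inverse-commutes {φ = φ} {φ′} {φ⁻¹} {x} {y} {ψ⁻¹} square retr sect = begin
    φ⁻¹ ∘ y                 ≈⟨ refl⟩∘⟨ identityʳ ⟨
    φ⁻¹ ∘ (y ∘ id)          ≈⟨ refl⟩∘⟨ refl⟩∘⟨ sect ⟨
    φ⁻¹ ∘ (y ∘ (φ ∘ ψ⁻¹))   ≈⟨ refl⟩∘⟨ assoc˘ ⟩
    φ⁻¹ ∘ ((y ∘ φ) ∘ ψ⁻¹)   ≈⟨ refl⟩∘⟨ square ⟩∘⟨refl ⟨
    φ⁻¹ ∘ ((φ′ ∘ x) ∘ ψ⁻¹)  ≈⟨ refl⟩∘⟨ assoc ⟩
    φ⁻¹ ∘ (φ′ ∘ (x ∘ ψ⁻¹))  ≈⟨ assoc˘ ⟩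
    (φ⁻¹ ∘ φ′) ∘ (x ∘ ψ⁻¹)  ≈⟨ retr ⟩∘⟨refl ⟩
    id ∘ (x ∘ ψ⁻¹)          ≈⟨ identityˡ ⟩
    x ∘ ψ⁻¹                 ∎

module FunctorLaws {o ℓ e o′ ℓ′ e′} {𝒞 : Category o ℓ e} {𝒟 : Category o′ ℓ′ e′}
                   (H : Functor 𝒞 𝒟) where
  private
    module 𝒞 = Category 𝒞
    module 𝒟 = Category 𝒟
  open Functor H
  open HomReasoning 𝒟

  F-square : ∀ {A B C D} {a : B 𝒞.⇒ D} {b : A 𝒞.⇒ B} {c : C 𝒞.⇒ D} {d : A 𝒞.⇒ C} →
             a 𝒞.∘ b 𝒞.≈ c 𝒞.∘ d → F₁ a 𝒟.∘ F₁ b 𝒟.≈ F₁ c 𝒟.∘ F₁ d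
  F-square p = ≈-trans (≈-sym homomorphism) (≈-trans (F-resp-≈ p) homomorphism)

module ProductLaws {o ℓ e} {𝒞 : Category o ℓ e} (P : FiniteProducts 𝒞) where
  open Category 𝒞
  open FiniteProducts P
  open HomReasoning 𝒞

  Δ : ∀ {X} → X ⇒ X ×₀ X
  Δ = ⟨ id , id ⟩

  ⟨⟩-jointly-monic : ∀ {X A B} {h k : X ⇒ A ×₀ B} →
                     π₁ ∘ h ≈ π₁ ∘ k → π₂ ∘ h ≈ π₂ ∘ k → h ≈ k
  ⟨⟩-jointly-monic p q =
    ≈-trans (≈-sym (⟨⟩-unique ≈-refl ≈-refl)) (⟨⟩-unique (≈-sym p) (≈-sym q))

  Δ-natural : ∀ {X Y} (f : X ⇒ Y) → Δ ∘ f ≈ (f ⁂ f) ∘ Δ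
  Δ-natural f = ⟨⟩-jointly-monic (both-sides project₁ project₁)
                                 (both-sides project₂ project₂)
    where
    both-sides : ∀ {π : ∀ {A} → A ×₀ A ⇒ A} →
                 (∀ {A} → π ∘ Δ {A} ≈ id) → π ∘ (f ⁂ f) ≈ f ∘ π →
                 π ∘ (Δ ∘ f) ≈ π ∘ ((f ⁂ f) ∘ Δ)
    both-sides {π} πΔ πf = begin
      π ∘ (Δ ∘ f)          ≈⟨ assoc˘ ⟩
      (π ∘ Δ) ∘ f          ≈⟨ πΔ ⟩∘⟨refl ⟩
      id ∘ f               ≈⟨ identityˡ ⟩
      f                    ≈⟨ identityʳ ⟨
      f ∘ id               ≈⟨ refl⟩∘⟨ πΔ ⟨
      f ∘ (π ∘ Δ)          ≈⟨ glue πf ≈-refl ⟨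
      (π ∘ (f ⁂ f)) ∘ Δ    ≈⟨ assoc ⟩
      π ∘ ((f ⁂ f) ∘ Δ)    ∎

module CoproductLaws {o ℓ e} {𝒞 : Category o ℓ e} (Co : FiniteCoproducts 𝒞) where
  open Category 𝒞
  open FiniteCoproducts Co
  open HomReasoning 𝒞

  ⊕₁-∘ : ∀ {A B C D E F} {a : B ⇒ C} {b : E ⇒ F} {c : A ⇒ B} {d : D ⇒ E} →
         (a ⊕₁ b) ∘ (c ⊕₁ d) ≈ (a ∘ c) ⊕₁ (b ∘ d)
  ⊕₁-∘ = ≈-sym ([]-unique (glue inject₁ inject₁) (glue inject₂ inject₂))

  ⊕₁-resp-≈ : ∀ {A B C D} {a a′ : A ⇒ B} {b b′ : C ⇒ D} →
              a ≈ a′ → b ≈ b′ → a ⊕₁ b ≈ a′ ⊕₁ b′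
  ⊕₁-resp-≈ p q = []-unique (≈-trans inject₁ (refl⟩∘⟨ ≈-sym p))
                            (≈-trans inject₂ (refl⟩∘⟨ ≈-sym q))

  ⊕₁-identity : ∀ {A B} → id {A} ⊕₁ id {B} ≈ id
  ⊕₁-identity = []-unique (≈-trans identityˡ (≈-sym identityʳ))
                          (≈-trans identityˡ (≈-sym identityʳ))

  ⊕₁-section : ∀ {A B C D} {a : B ⇒ A} {b : D ⇒ C} {c : A ⇒ B} {d : C ⇒ D} →
               a ∘ c ≈ id → b ∘ d ≈ id → (a ⊕₁ b) ∘ (c ⊕₁ d) ≈ id
  ⊕₁-section p q = ≈-trans ⊕₁-∘ (≈-trans (⊕₁-resp-≈ p q) ⊕₁-identity)

module MonoidalLaws {o ℓ e} {𝒞 : Category o ℓ e} (SM : SymmetricMonoidal 𝒞) where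
  open Category 𝒞
  open SymmetricMonoidal SM
  open HomReasoning 𝒞

  ⊗-square : ∀ {A A′ B B′ C C′ D D′}
               {a : B ⇒ D} {b : A ⇒ B} {c : C ⇒ D} {d : A ⇒ C}
               {a′ : B′ ⇒ D′} {b′ : A′ ⇒ B′} {c′ : C′ ⇒ D′} {d′ : A′ ⇒ C′} →
             a ∘ b ≈ c ∘ d → a′ ∘ b′ ≈ c′ ∘ d′ →
             (a ⊗₁ a′) ∘ (b ⊗₁ b′) ≈ (c ⊗₁ c′) ∘ (d ⊗₁ d′)
  ⊗-square p q = ≈-trans (≈-sym ⊗-homo) (≈-trans (⊗-resp-≈ p q) ⊗-homo)

  ⊗-section : ∀ {A B C D} {a : B ⇒ A} {b : D ⇒ C} {c : A ⇒ B} {d : C ⇒ D} →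
              a ∘ c ≈ id → b ∘ d ≈ id → (a ⊗₁ b) ∘ (c ⊗₁ d) ≈ id
  ⊗-section p q = ≈-trans (≈-sym ⊗-homo) (≈-trans (⊗-resp-≈ p q) ⊗-identity)

module IntuitionisticMorphisms {o ℓ e o′ ℓ′ e′} (M : CLNL o ℓ e o′ ℓ′ e′) where
  open CLNL M
  open C
  open HomReasoning C
  open F using (F₀; F₁)
  open G using () renaming (F₀ to G₀; F₁ to G₁)
  open ProductLaws Vprod using (Δ; Δ-natural)
  open CoproductLaws Ccoprod using (⊕₁-section)
  open MonoidalLaws CM.symmetricMonoidal using (⊗-square; ⊗-section)
  module VR = HomReasoning V

  transpose : ∀ {X A} → F₀ X ⇒ A → X V.⇒ G₀ A
  transpose {X} g = G₁ g V.∘ η X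

  transpose-inverse : ∀ {X A} (g : F₀ X ⇒ A) → ε A ∘ F₁ (transpose g) ≈ g
  transpose-inverse {X} {A} g = begin
    ε A ∘ F₁ (G₁ g V.∘ η X)        ≈⟨ refl⟩∘⟨ F.homomorphism ⟩
    ε A ∘ (F₁ (G₁ g) ∘ F₁ (η X))   ≈⟨ assoc˘ ⟩
    (ε A ∘ F₁ (G₁ g)) ∘ F₁ (η X)   ≈⟨ ε-natural ⟩∘⟨refl ⟨
    (g ∘ ε (F₀ X)) ∘ F₁ (η X)      ≈⟨ assoc ⟩
    g ∘ (ε (F₀ X) ∘ F₁ (η X))      ≈⟨ refl⟩∘⟨ zig ⟩
    g ∘ id                         ≈⟨ identityʳ ⟩
    g                              ∎

  transpose-injective : ∀ {X A} {g h : F₀ X ⇒ A} →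
                        transpose g V.≈ transpose h → g ≈ h
  transpose-injective {g = g} {h} p = begin
    g                         ≈⟨ transpose-inverse g ⟨
    ε _ ∘ F₁ (transpose g)    ≈⟨ refl⟩∘⟨ F.F-resp-≈ p ⟩
    ε _ ∘ F₁ (transpose h)    ≈⟨ transpose-inverse h ⟩
    h                         ∎

  transpose-natural : ∀ {X Y A} (k : X V.⇒ Y) (g : F₀ Y ⇒ A) →
                      transpose g V.∘ k V.≈ transpose (g ∘ F₁ k)
  transpose-natural {X} {Y} k g = VR.begin
    (G₁ g V.∘ η Y) V.∘ k             VR.≈⟨ V.assoc ⟩
    G₁ g V.∘ (η Y V.∘ k)             VR.≈⟨ VR.refl⟩∘⟨ η-natural ⟨
    G₁ g V.∘ (G₁ (F₁ k) V.∘ η X)     VR.≈⟨ VR.assoc˘ ⟩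
    (G₁ g V.∘ G₁ (F₁ k)) V.∘ η X     VR.≈⟨ G.homomorphism VR.⟩∘⟨refl ⟨
    G₁ (g ∘ F₁ k) V.∘ η X            VR.∎

  F∅-initial : ∀ {A} {g h : F₀ VC.⊥ ⇒ A} → g ≈ h
  F∅-initial = transpose-injective
    (VR.≈-trans (VR.≈-sym (VC.¡-unique _)) (VC.¡-unique _))

  F+-jointly-epic : ∀ {X Y A} {g h : F₀ (X VC.+₀ Y) ⇒ A} →
                    g ∘ F₁ VC.i₁ ≈ h ∘ F₁ VC.i₁ → g ∘ F₁ VC.i₂ ≈ h ∘ F₁ VC.i₂ →
                    g ≈ h
  F+-jointly-epic {g = g} {h} p q = transpose-injective
    (VR.≈-trans (VR.≈-sym (VC.[]-unique VR.≈-refl VR.≈-refl))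
                (VC.[]-unique (agree VC.i₁ p) (agree VC.i₂ q)))
    where
    agree : ∀ {Z} (ι : Z V.⇒ _) → g ∘ F₁ ι ≈ h ∘ F₁ ι →
            transpose h V.∘ ι V.≈ transpose g V.∘ ι
    agree ι r = VR.≈-trans (transpose-natural ι h)
      (VR.≈-trans (G.F-resp-≈ (≈-sym r) VR.⟩∘⟨refl)
                  (VR.≈-sym (transpose-natural ι g)))

  +→F-section : ∀ {X Y} → +→F {X} {Y} ∘ F→+ ≈ id
  +→F-section {X} {Y} = F+-jointly-epic (on VC.inject₁ CC.inject₁)
                                        (on VC.inject₂ CC.inject₂)
    where
    on : ∀ {Z} {vι : Z V.⇒ X VC.+₀ Y} {cι : F₀ Z ⇒ F₀ X CC.+₀ F₀ Y} →
         VC.[ transpose CC.i₁ , transpose CC.i₂ ] V.∘ vι V.≈ transpose cι →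
         +→F ∘ cι ≈ F₁ vι →
         (+→F ∘ F→+) ∘ F₁ vι ≈ id ∘ F₁ vι
    on {vι = vι} {cι} p q = begin
      (+→F ∘ (ε _ ∘ F₁ _)) ∘ F₁ vι     ≈⟨ assoc ⟩
      +→F ∘ ((ε _ ∘ F₁ _) ∘ F₁ vι)     ≈⟨ refl⟩∘⟨ assoc ⟩
      +→F ∘ (ε _ ∘ (F₁ _ ∘ F₁ vι))     ≈⟨ refl⟩∘⟨ refl⟩∘⟨ F.homomorphism ⟨
      +→F ∘ (ε _ ∘ F₁ (_ V.∘ vι))      ≈⟨ refl⟩∘⟨ refl⟩∘⟨ F.F-resp-≈ p ⟩
      +→F ∘ (ε _ ∘ F₁ (transpose cι))  ≈⟨ refl⟩∘⟨ transpose-inverse cι ⟩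
      +→F ∘ cι                         ≈⟨ q ⟩
      F₁ vι                            ≈⟨ identityˡ ⟨
      id ∘ F₁ vι                       ∎

  toF-fromF : ∀ {P} (p : Intuitionistic P) → toF M p ∘ fromF M p ≈ id
  toF-fromF 𝟘       = F∅-initial
  toF-fromF (p ⊕ r) = section-∘ +→F-section (⊕₁-section (toF-fromF p) (toF-fromF r))
  toF-fromF 𝟙       = φ₀-isoʳ
  toF-fromF (p ⊗ r) = section-∘ φ-isoʳ (⊗-section (toF-fromF p) (toF-fromF r))
  toF-fromF (! A)   = identityˡ

  φ⁻¹-natural : ∀ {A B C D} {a : A V.⇒ B} {b : C V.⇒ D} →
                φ⁻¹ ∘ F₁ (a VP.⁂ b) ≈ (F₁ a CM.⊗₁ F₁ b) ∘ φ⁻¹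
  φ⁻¹-natural = inverse-commutes Fm.φ-natural φ-isoˡ φ-isoʳ

  Fη-natural : ∀ {X Y} (k : X V.⇒ Y) → F₁ (η Y V.∘ k) ≈ !₁ (F₁ k) ∘ F₁ (η X)
  Fη-natural k = ≈-trans (F.F-resp-≈ (VR.≈-sym η-natural)) F.homomorphism

  module _ {P₁ P₂} (p₁ : Intuitionistic P₁) (p₂ : Intuitionistic P₂)
           {f : ⟦ M ⟧ P₁ ⇒ ⟦ M ⟧ P₂} {f′ : under M p₁ V.⇒ under M p₂}
           (f≈ : f ≈ fromF M p₂ ∘ (F₁ f′ ∘ toF M p₁)) where

    toF-intertwines : toF M p₂ ∘ f ≈ F₁ f′ ∘ toF M p₁
    toF-intertwines = begin
      toF M p₂ ∘ f                                   ≈⟨ refl⟩∘⟨ f≈ ⟩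
      toF M p₂ ∘ (fromF M p₂ ∘ (F₁ f′ ∘ toF M p₁))   ≈⟨ assoc˘ ⟩
      (toF M p₂ ∘ fromF M p₂) ∘ (F₁ f′ ∘ toF M p₁)   ≈⟨ toF-fromF p₂ ⟩∘⟨refl ⟩
      id ∘ (F₁ f′ ∘ toF M p₁)                        ≈⟨ identityˡ ⟩
      F₁ f′ ∘ toF M p₁                               ∎

    fromF-intertwines : f ∘ fromF M p₁ ≈ fromF M p₂ ∘ F₁ f′
    fromF-intertwines = begin
      f ∘ fromF M p₁                                     ≈⟨ f≈ ⟩∘⟨refl ⟩
      (fromF M p₂ ∘ (F₁ f′ ∘ toF M p₁)) ∘ fromF M p₁     ≈⟨ assoc ⟩
      fromF M p₂ ∘ ((F₁ f′ ∘ toF M p₁) ∘ fromF M p₁)     ≈⟨ refl⟩∘⟨ assoc ⟩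
      fromF M p₂ ∘ (F₁ f′ ∘ (toF M p₁ ∘ fromF M p₁))     ≈⟨ refl⟩∘⟨ refl⟩∘⟨ toF-fromF p₁ ⟩
      fromF M p₂ ∘ (F₁ f′ ∘ id)                          ≈⟨ refl⟩∘⟨ identityʳ ⟩
      fromF M p₂ ∘ F₁ f′                                 ∎

  throughF : ∀ {P X A} (p : Intuitionistic P) → F₀ X ⇒ A → under M p V.⇒ X →
             ⟦ M ⟧ P ⇒ A
  throughF p a k = a ∘ (F₁ k ∘ toF M p)

  throughF-natural :
    ∀ {P₁ P₂ X₁ X₂ A₁ A₂} (p₁ : Intuitionistic P₁) (p₂ : Intuitionistic P₂)
      {f : ⟦ M ⟧ P₁ ⇒ ⟦ M ⟧ P₂} {f′ : under M p₁ V.⇒ under M p₂}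
      {a₁ : F₀ X₁ ⇒ A₁} {k₁ : under M p₁ V.⇒ X₁}
      {a₂ : F₀ X₂ ⇒ A₂} {k₂ : under M p₂ V.⇒ X₂} {c : A₁ ⇒ A₂} →
    toF M p₂ ∘ f ≈ F₁ f′ ∘ toF M p₁ →
    a₂ ∘ F₁ (k₂ V.∘ f′) ≈ c ∘ (a₁ ∘ F₁ k₁) →
    throughF p₂ a₂ k₂ ∘ f ≈ c ∘ throughF p₁ a₁ k₁
  throughF-natural p₁ p₂ {f} {f′} {a₁} {k₁} {a₂} {k₂} {c} toF≈ core = begin
    (a₂ ∘ (F₁ k₂ ∘ toF M p₂)) ∘ f       ≈⟨ assoc ⟩
    a₂ ∘ ((F₁ k₂ ∘ toF M p₂) ∘ f)       ≈⟨ refl⟩∘⟨ assoc ⟩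
    a₂ ∘ (F₁ k₂ ∘ (toF M p₂ ∘ f))       ≈⟨ refl⟩∘⟨ refl⟩∘⟨ toF≈ ⟩
    a₂ ∘ (F₁ k₂ ∘ (F₁ f′ ∘ toF M p₁))   ≈⟨ refl⟩∘⟨ assoc˘ ⟩
    a₂ ∘ ((F₁ k₂ ∘ F₁ f′) ∘ toF M p₁)   ≈⟨ refl⟩∘⟨ F.homomorphism ⟩∘⟨refl ⟨
    a₂ ∘ (F₁ (k₂ V.∘ f′) ∘ toF M p₁)    ≈⟨ assoc˘ ⟩
    (a₂ ∘ F₁ (k₂ V.∘ f′)) ∘ toF M p₁    ≈⟨ core ⟩∘⟨refl ⟩
    (c ∘ (a₁ ∘ F₁ k₁)) ∘ toF M p₁       ≈⟨ assoc ⟩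
    c ∘ ((a₁ ∘ F₁ k₁) ∘ toF M p₁)       ≈⟨ refl⟩∘⟨ assoc ⟩
    c ∘ (a₁ ∘ (F₁ k₁ ∘ toF M p₁))       ∎

  fromF-⊗-intertwines :
    ∀ {P₁ P₂ R₁ R₂} (p₁ : Intuitionistic P₁) (p₂ : Intuitionistic P₂)
      (r₁ : Intuitionistic R₁) (r₂ : Intuitionistic R₂)
      {f : ⟦ M ⟧ P₁ ⇒ ⟦ M ⟧ P₂} {f′ : under M p₁ V.⇒ under M p₂}
      {g : ⟦ M ⟧ R₁ ⇒ ⟦ M ⟧ R₂} {g′ : under M r₁ V.⇒ under M r₂} →
    f ∘ fromF M p₁ ≈ fromF M p₂ ∘ F₁ f′ → g ∘ fromF M r₁ ≈ fromF M r₂ ∘ F₁ g′ →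
    fromF M (p₂ ⊗ r₂) ∘ F₁ (f′ VP.⁂ g′) ≈ (f CM.⊗₁ g) ∘ fromF M (p₁ ⊗ r₁)
  fromF-⊗-intertwines _ _ _ _ f≈ g≈ = glue (⊗-square (≈-sym f≈) (≈-sym g≈)) φ⁻¹-natural

  module _ {P₁ P₂} (p₁ : Intuitionistic P₁) (p₂ : Intuitionistic P₂)
           (f : ⟦ M ⟧ P₁ ⇒ ⟦ M ⟧ P₂) (f′ : under M p₁ V.⇒ under M p₂)
           (f≈ : f ≈ fromF M p₂ ∘ (F₁ f′ ∘ toF M p₁)) where

    discard-natural : discard M p₂ ∘ f ≈ discard M p₁
    discard-natural = ≈-trans (throughF-natural p₁ p₂ (toF-intertwines p₁ p₂ f≈) core) identityˡ
      where
      core : φ₀⁻¹ ∘ F₁ (VP.! V.∘ f′) ≈ id ∘ (φ₀⁻¹ ∘ F₁ VP.!)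
      core = ≈-trans (refl⟩∘⟨ F.F-resp-≈ (VR.≈-sym (VP.!-unique _))) (≈-sym identityˡ)

    copy-natural : copy M p₂ ∘ f ≈ (f CM.⊗₁ f) ∘ copy M p₁
    copy-natural = throughF-natural p₁ p₂ (toF-intertwines p₁ p₂ f≈) (begin
      fromF M (p₂ ⊗ p₂) ∘ F₁ (Δ V.∘ f′)                ≈⟨ refl⟩∘⟨ F.F-resp-≈ (Δ-natural f′) ⟩
      fromF M (p₂ ⊗ p₂) ∘ F₁ ((f′ VP.⁂ f′) V.∘ Δ)      ≈⟨ refl⟩∘⟨ F.homomorphism ⟩
      fromF M (p₂ ⊗ p₂) ∘ (F₁ (f′ VP.⁂ f′) ∘ F₁ Δ)     ≈⟨ assoc˘ ⟩
      (fromF M (p₂ ⊗ p₂) ∘ F₁ (f′ VP.⁂ f′)) ∘ F₁ Δ     ≈⟨ fromF-⊗-intertwines p₁ p₂ p₁ p₂ ffrom ffrom ⟩∘⟨refl ⟩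
      ((f CM.⊗₁ f) ∘ fromF M (p₁ ⊗ p₁)) ∘ F₁ Δ         ≈⟨ assoc ⟩
      (f CM.⊗₁ f) ∘ (fromF M (p₁ ⊗ p₁) ∘ F₁ Δ)         ∎)
      where
      ffrom : f ∘ fromF M p₁ ≈ fromF M p₂ ∘ F₁ f′
      ffrom = fromF-intertwines p₁ p₂ f≈

    lift-natural : lift M p₂ ∘ f ≈ !₁ f ∘ lift M p₁
    lift-natural = throughF-natural p₁ p₂ (toF-intertwines p₁ p₂ f≈) (begin
      !₁ (fromF M p₂) ∘ F₁ (η _ V.∘ f′)                ≈⟨ refl⟩∘⟨ Fη-natural f′ ⟩
      !₁ (fromF M p₂) ∘ (!₁ (F₁ f′) ∘ F₁ (η _))        ≈⟨ assoc˘ ⟩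
      (!₁ (fromF M p₂) ∘ !₁ (F₁ f′)) ∘ F₁ (η _)        ≈⟨ !-square ⟩∘⟨refl ⟩
      (!₁ f ∘ !₁ (fromF M p₁)) ∘ F₁ (η _)              ≈⟨ assoc ⟩
      !₁ f ∘ (!₁ (fromF M p₁) ∘ F₁ (η _))              ∎)
      where
      !-square : !₁ (fromF M p₂) ∘ !₁ (F₁ f′) ≈ !₁ f ∘ !₁ (fromF M p₁)
      !-square = FunctorLaws.F-square F
                   (FunctorLaws.F-square G (≈-sym (fromF-intertwines p₁ p₂ f≈)))

mainTheorem2 : ∀ {o ℓ e o′ ℓ′ e′} (M : CLNL o ℓ e o′ ℓ′ e′) →
    let open CLNL M in
    ∀ {P₁ P₂} (p₁ : Intuitionistic P₁) (p₂ : Intuitionistic P₂)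
    (f : ⟦ M ⟧ P₁ C.⇒ ⟦ M ⟧ P₂) →
    IsIntuitionisticMor M p₁ p₂ f →
    (discard M p₂ C.∘ f C.≈ discard M p₁)
    × (copy M p₂ C.∘ f C.≈ (f CM.⊗₁ f) C.∘ copy M p₁)
    × (lift M p₂ C.∘ f C.≈ !₁ f C.∘ lift M p₁)
mainTheorem2 M p₁ p₂ f (f′ , f≈) =
  discard-natural p₁ p₂ f f′ f≈ , copy-natural p₁ p₂ f f′ f≈ , lift-natural p₁ p₂ f f′ f≈
  where open IntuitionisticMorphisms M
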